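{- There exists $n_0$ such that for every even integer $n\geq n_0$, there is a $(2,5)$ knight's tour in $[n]^2$.
   Context: $[n]=\{0,\dots,n-1\}$. The $(2,5)$ knight's graph on $[n]^2$ has vertex set $[n]^2$, with $(x,y)\sim(x',y')$ iff $\{|x-x'|,|y-y'|\}=\{2,5\}$; a $(2,5)$ knight's tour is a Hamiltonian cycle of it. -}

module Defs where

open import Data.Nat using (ℕ; suc; _+_; _*_; _∸_)
open import Data.Fin using (Fin; toℕ)
open import Data.Fin.Base using () renaming (suc to fsuc)
open import Data.Product using (_×_; _,_; Σ)
open import Data.Sum using (_⊎_)
open import Relation.Binary.PropositionalEquality using (_≡_)
open import Function.Bundles using (_⤖_; Bijection)

dist : ℕ → ℕ → ℕ
dist a b = (a ∸ b) + (b ∸ a)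

Cell : ℕ → Set
Cell n = Fin n × Fin n

KnightAdj : {n : ℕ} → Cell n → Cell n → Set
KnightAdj (x , y) (x' , y') =
  (dist (toℕ x) (toℕ x') ≡ 2 × dist (toℕ y) (toℕ y') ≡ 5)
  ⊎ (dist (toℕ x) (toℕ x') ≡ 5 × dist (toℕ y) (toℕ y') ≡ 2)

next : {m : ℕ} → Fin (suc m) → Fin (suc m)
next {m} i = Data.Fin.fromℕ< (Data.Nat.DivMod.m%n<n (suc (toℕ i)) (suc m))
  where import Data.Nat.DivMod

-- A Hamiltonian cycle of a graph on a vertex type V with |V| = suc m vertices,
-- given as a cyclic ordering: a bijection c : Fin (suc m) ⤖ V such that
-- consecutive vertices (including the last and the first) are adjacent.
-- (A genuine cycle additionally needs at least 3 vertices.)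
record HamiltonianCycle {V : Set} (m : ℕ) (Adj : V → V → Set) : Set where
  field
    order    : Fin (suc m) ⤖ V
    atLeast3 : 2 Data.Nat.≤ m
    adjacent : ∀ i → Adj (Bijection.to order i) (Bijection.to order (next i))

-- a (2,5) knight's tour on [n]^2 (n ≥ 1, so n*n = suc m with m = n*n - 1)
KnightsTour : ℕ → Set
KnightsTour n = Σ ℕ λ m → Σ (suc m ≡ n * n) λ eq →
  HamiltonianCycle {Cell n} m KnightAdj

-- Cut the n × n board into blocks whose sides are 14 or 20; this is possible for every
-- even n ≥ 108, because every q ≥ 54 = 7 · 10 − 7 − 10 + 1 is of the form 7a + 10b.
-- Each of the four block shapes carries a Hamiltonian cycle of the (2,5) knight graph,
-- checked by computation, which uses certain moves near the corners of the block.
-- Two adjacent blocks are merged by deleting one such move in each of them and adding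
-- the two knight moves that cross the seam (this only needs sides ≥ 5). Merging each
-- row from right to left, and the rows from top to bottom through the first column,
-- gives a Hamiltonian path from (2,0) to (7,2), which the move (7,2) → (2,0) closes.
module Submission where

open import Defs
open import Data.Nat using (ℕ; _≤_; _*_)
open import Data.Product using (Σ)
open import Data.Nat.Divisibility using (_∣_)

open import Level using (0ℓ)
open import Function using (_∘_; Injective)
open import Function.Bundles using (_⤖_; mk⤖; module Equivalence)
open import Function.Properties.Bijection using (⤖⇒↔)
open import Function.Properties.Inverse using (↔-trans; ↔-sym)
open import Relation.Binary.Core using (Rel)
open import Relation.Binary.PropositionalEquality
open import Relation.Nullary using (yes; no; contradiction)
open import Relation.Unary using (Pred; _∪_; _⊥_; _≐_; _⊆_)
open import Relation.Unary.Properties using (≐-sym)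

open import Data.Bool using (Bool; true; false; T; not; _∧_; _∨_)
open import Data.Bool.ListAction using (any; all)
open import Data.Bool.Properties using (T-∧; T-∨; T-not-≡)
open import Data.Nat using (zero; suc; _+_; _∸_; _<_; z≤n; s≤s; _<?_; _≡ᵇ_; _<ᵇ_)
open import Data.Nat.Properties
open import Data.Nat.DivMod using (_%_; m<n⇒m%n≡m; n%n≡0)
open import Data.Nat.Divisibility using (divides)
open import Data.Nat.ListAction using (sum)
open import Data.Fin using (Fin; zero; suc; toℕ; fromℕ<)
open import Data.Fin.Properties using (toℕ-fromℕ<; toℕ-injective; toℕ<n; *↔×)
open import Data.Fin.Permutation using (↔⇒≡)
open import Data.Product using (∃; ∃₂; _×_; _,_; proj₁; proj₂)
open import Data.Sum using (inj₁; inj₂)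
import Data.Sum as Sum
open import Data.Maybe using (Maybe; just; nothing)
import Data.Maybe as Maybe
open import Data.Maybe.Properties using (just-injective)
open import Data.Maybe.Relation.Binary.Connected using (Connected; just)
open import Data.List using (List; []; _∷_; _++_; map; head; last; upTo; take; drop; length; lookup)
open import Data.List.Properties using (++-assoc; head-map; last-map; take++drop≡id)
open import Data.List.Membership.Propositional using (_∈_; _∉_)
open import Data.List.Membership.Propositional.Properties
  using (∈-++⁺ˡ; ∈-++⁺ʳ; ∈-map⁺; ∈-upTo⁺; ∈-lookup)
open import Data.List.Relation.Unary.All as All using (All; []; _∷_)
import Data.List.Relation.Unary.All.Properties as All
open import Data.List.Relation.Unary.All.Properties using (all⁺; ¬Any⇒All¬)
import Data.List.Relation.Unary.Any as Any
open import Data.List.Relation.Unary.Any.Properties using (any⁺; any⁻; lookup-index)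
open import Data.List.Relation.Unary.AllPairs using ([]; _∷_)
open import Data.List.Relation.Unary.Linked using (Linked; []; [-]; _∷_)
import Data.List.Relation.Unary.Linked.Properties as Linked
open import Data.List.Relation.Unary.Unique.Propositional using (Unique)
import Data.List.Relation.Unary.Unique.Propositional.Properties as Unique
open import Data.List.Relation.Binary.Permutation.Propositional
  using (_↭_; ↭-trans; ↭-reflexive; ↭⇒↭ₛ)
open import Data.List.Relation.Binary.Permutation.Propositional.Properties
  using (All-resp-↭; ∈-resp-↭; ++⁺ˡ; ++-comm)
import Data.List.Relation.Binary.Permutation.Setoid.Properties as PermutationSetoid

open Equivalence using (to; from)

-- Enumerations and Hamiltonian paths

module _ {A : Set} where

  record Enumerates (R : Pred A 0ℓ) (xs : List A) : Set where
    field
      unique   : Unique xs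
      sound    : All R xs
      complete : R ⊆ (_∈ xs)

  open Enumerates

  enumerates-resp-↭ : ∀ {R xs ys} → xs ↭ ys → Enumerates R xs → Enumerates R ys
  enumerates-resp-↭ p e = record
    { unique   = PermutationSetoid.Unique-resp-↭ (setoid A) (↭⇒↭ₛ p) (unique e)
    ; sound    = All-resp-↭ p (sound e)
    ; complete = ∈-resp-↭ p ∘ complete e
    }

  enumerates-resp-≐ : ∀ {R S xs} → R ≐ S → Enumerates R xs → Enumerates S xs
  enumerates-resp-≐ (R⊆S , S⊆R) e = record
    { unique = unique e ; sound = All.map R⊆S (sound e) ; complete = complete e ∘ S⊆R }

  enumerates-++ : ∀ {R S xs ys} → R ⊥ S → Enumerates R xs → Enumerates S ys →
                  Enumerates (R ∪ S) (xs ++ ys)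
  enumerates-++ {xs = xs} R⊥S e f = record
    { unique   = Unique.++⁺ (unique e) (unique f)
                   (λ (x∈xs , x∈ys) → R⊥S (All.lookup (sound e) x∈xs , All.lookup (sound f) x∈ys))
    ; sound    = All.++⁺ (All.map inj₁ (sound e)) (All.map inj₂ (sound f))
    ; complete = λ { (inj₁ r) → ∈-++⁺ˡ (complete e r) ; (inj₂ s) → ∈-++⁺ʳ xs (complete f s) }
    }

  enumerates-insert : ∀ {R S} xs {ys zs} → R ⊥ S → Enumerates R (xs ++ zs) → Enumerates S ys →
                      Enumerates (R ∪ S) (xs ++ ys ++ zs)
  enumerates-insert xs {ys} {zs} R⊥S e f = enumerates-resp-↭ reorder (enumerates-++ R⊥S e f)
    where
    reorder : (xs ++ zs) ++ ys ↭ xs ++ ys ++ zs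
    reorder = ↭-trans (↭-reflexive (++-assoc xs zs ys)) (++⁺ˡ xs (++-comm zs ys))

  enumerates-map : ∀ {R S xs} {f : A → A} → Injective _≡_ _≡_ f →
                   (∀ {x} → R x → S (f x)) → (∀ {y} → S y → ∃ λ x → R x × f x ≡ y) →
                   Enumerates R xs → Enumerates S (map f xs)
  enumerates-map {S = S} {xs} {f} f-injective f-into f-onto e = record
    { unique   = Unique.map⁺ f-injective (unique e)
    ; sound    = All.map⁺ (All.map f-into (sound e))
    ; complete = complete′
    }
    where
    complete′ : S ⊆ (_∈ map f xs)
    complete′ s with x , r , refl ← f-onto s = ∈-map⁺ f (complete e r)

module _ {A : Set} (_~_ : Rel A 0ℓ) where

  record Walk (u v : A) (xs : List A) : Set where
    field
      linked : Linked _~_ xs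
      start  : head xs ≡ just u
      end    : last xs ≡ just v

  open Walk

  walk-++ : ∀ {u v u′ v′ xs ys} → Walk u v xs → v ~ u′ → Walk u′ v′ ys → Walk u v′ (xs ++ ys)
  walk-++ {xs = xs} p v~u′ q = record
    { linked = Linked.++⁺ (linked p) (subst₂ (Connected _~_) (sym (end p)) (sym (start q)) (just v~u′))
                 (linked q)
    ; start  = head-++ xs (start p)
    ; end    = last-++ xs (end q)
    }
    where
    head-++ : ∀ xs {u ys} → head xs ≡ just u → head (xs ++ ys) ≡ just u
    head-++ (_ ∷ _) eq = eq
    last-++ : ∀ xs {v ys} → last ys ≡ just v → last (xs ++ ys) ≡ just v
    last-++ []                        eq = eq
    last-++ (_ ∷ [])     {ys = _ ∷ _} eq = eq
    last-++ (_ ∷ y ∷ xs)              eq = last-++ (y ∷ xs) eq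

  record HamPath (R : Pred A 0ℓ) (u v : A) : Set where
    field
      vertices   : List A
      walk       : Walk u v vertices
      enumerates : Enumerates R vertices

  record SplitPath (R : Pred A 0ℓ) (u v u′ v′ : A) : Set where
    field
      front back : List A
      front-walk : Walk u v front
      back-walk  : Walk u′ v′ back
      enumerates : Enumerates R (front ++ back)

  join : ∀ {R u v u′ v′} → v ~ u′ → SplitPath R u v u′ v′ → HamPath R u v′
  join v~u′ P = record
    { walk = walk-++ (SplitPath.front-walk P) v~u′ (SplitPath.back-walk P)
    ; enumerates = SplitPath.enumerates P
    }

  splice : ∀ {R S u v u′ v′ s t} → R ⊥ S → v ~ s → t ~ u′ →
           SplitPath R u v u′ v′ → HamPath S s t → HamPath (R ∪ S) u v′
  splice R⊥S v~s t~u′ P M = record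
    { walk       = walk-++ (SplitPath.front-walk P) v~s
                     (walk-++ (HamPath.walk M) t~u′ (SplitPath.back-walk P))
    ; enumerates = enumerates-insert (SplitPath.front P) R⊥S (SplitPath.enumerates P)
                     (HamPath.enumerates M)
    }

  hamPath-resp-≐ : ∀ {R S u v} → R ≐ S → HamPath R u v → HamPath S u v
  hamPath-resp-≐ R≐S P = record
    { walk = HamPath.walk P ; enumerates = enumerates-resp-≐ R≐S (HamPath.enumerates P) }

  module _ {f : A → A} (f-hom : ∀ {x y} → x ~ y → f x ~ f y) where

    walk-map : ∀ {u v xs} → Walk u v xs → Walk (f u) (f v) (map f xs)
    walk-map {xs = xs} p = record
      { linked = Linked.map⁺ (linked-hom (linked p))
      ; start  = trans (head-map xs) (cong (Maybe.map f) (start p))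
      ; end    = trans (last-map f xs) (cong (Maybe.map f) (end p))
      }
      where
      linked-hom : ∀ {ys} → Linked _~_ ys → Linked (λ x y → f x ~ f y) ys
      linked-hom []       = []
      linked-hom [-]      = [-]
      linked-hom (r ∷ rs) = f-hom r ∷ linked-hom rs

    hamPath-map : ∀ {R S u v} → Injective _≡_ _≡_ f → (∀ {x} → R x → S (f x)) →
                  (∀ {y} → S y → ∃ λ x → R x × f x ≡ y) → HamPath R u v → HamPath S (f u) (f v)
    hamPath-map f-injective f-into f-onto P = record
      { walk       = walk-map (HamPath.walk P)
      ; enumerates = enumerates-map f-injective f-into f-onto (HamPath.enumerates P)
      }

-- The (2,5) knight graph on ℕ²

Pos : Set
Pos = ℕ × ℕ

data Knight : Rel Pos 0ℓ where
  step₂₅ : ∀ {x y x′ y′} → dist x x′ ≡ 2 → dist y y′ ≡ 5 → Knight (x , y) (x′ , y′)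
  step₅₂ : ∀ {x y x′ y′} → dist x x′ ≡ 5 → dist y y′ ≡ 2 → Knight (x , y) (x′ , y′)

_⊕_ : Pos → Pos → Pos
(a , b) ⊕ (x , y) = (a + x , b + y)

⊕-injective : ∀ o → Injective _≡_ _≡_ (o ⊕_)
⊕-injective (a , b) {x , y} {x′ , y′} eq =
  cong₂ _,_ (+-cancelˡ-≡ a x x′ (cong proj₁ eq)) (+-cancelˡ-≡ b y y′ (cong proj₂ eq))

dist-comm : ∀ m n → dist m n ≡ dist n m
dist-comm m n = +-comm (m ∸ n) (n ∸ m)

dist-+ : ∀ k m n → dist (k + m) (k + n) ≡ dist m n
dist-+ k m n = cong₂ _+_ ([m+n]∸[m+o]≡n∸o k m n) ([m+n]∸[m+o]≡n∸o k n m)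

dist-offset : ∀ n k → dist k (n + k) ≡ n
dist-offset n k = cong₂ _+_ (m≤n⇒m∸n≡0 (m≤n+m k n)) (m+n∸n≡m n k)

knight-⊕ : ∀ o {p q} → Knight p q → Knight (o ⊕ p) (o ⊕ q)
knight-⊕ (a , b) (step₂₅ {x} {y} {x′} {y′} dx dy) =
  step₂₅ (trans (dist-+ a x x′) dx) (trans (dist-+ b y y′) dy)
knight-⊕ (a , b) (step₅₂ {x} {y} {x′} {y′} dx dy) =
  step₅₂ (trans (dist-+ a x x′) dx) (trans (dist-+ b y y′) dy)

knight-swap : ∀ {x y x′ y′} → Knight (x , y) (x′ , y′) → Knight (y , x) (y′ , x′)
knight-swap (step₂₅ dx dy) = step₅₂ dy dx
knight-swap (step₅₂ dx dy) = step₂₅ dy dx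

≥5-elim : ∀ (P : ℕ → Set) → (∀ k → P (5 + k)) → ∀ {w} → 5 ≤ w → P w
≥5-elim P P5+ {w} 5≤w = subst P (m+[n∸m]≡n 5≤w) (P5+ (w ∸ 5))

knight-cut : ∀ {w} → 5 ≤ w → Knight (w ∸ 5 , 0) (w ∸ 3 , 5)
knight-cut = ≥5-elim (λ w → Knight (w ∸ 5 , 0) (w ∸ 3 , 5)) λ k → step₂₅ (dist-offset 2 k) refl

knight-exit : ∀ {w} → 5 ≤ w → Knight (w ∸ 5 , 0) ((w , 0) ⊕ (0 , 2))
knight-exit = ≥5-elim (λ w → Knight (w ∸ 5 , 0) ((w , 0) ⊕ (0 , 2))) λ k →
  step₅₂ (trans (cong (dist k) (+-identityʳ (5 + k))) (dist-offset 5 k)) refl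

knight-return : ∀ {w} → 5 ≤ w → Knight ((w , 0) ⊕ (2 , 7)) (w ∸ 3 , 5)
knight-return = ≥5-elim (λ w → Knight ((w , 0) ⊕ (2 , 7)) (w ∸ 3 , 5)) λ k →
  step₅₂ (trans (cong (λ m → dist m (2 + k)) (+-comm (5 + k) 2))
                (trans (dist-comm (5 + k) k) (dist-offset 5 k)))
         refl

Interval : ℕ → ℕ → Pred ℕ 0ℓ
Interval a w x = a ≤ x × x < a + w

Rect : Pos → ℕ → ℕ → Pred Pos 0ℓ
Rect (a , b) w h (x , y) = Interval a w x × Interval b h y

Box : ℕ → ℕ → Pred Pos 0ℓ
Box = Rect (0 , 0)

interval-split : ∀ a w v → Interval a (w + v) ≐ Interval a w ∪ Interval (a + w) v
interval-split a w v = split , merge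
  where
  split : Interval a (w + v) ⊆ Interval a w ∪ Interval (a + w) v
  split {x} (a≤x , x<) with x <? a + w
  ... | yes x<a+w = inj₁ (a≤x , x<a+w)
  ... | no  x≮a+w = inj₂ (≮⇒≥ x≮a+w , subst (x <_) (sym (+-assoc a w v)) x<)
  merge : Interval a w ∪ Interval (a + w) v ⊆ Interval a (w + v)
  merge     (inj₁ (a≤x , x<))   = a≤x , <-≤-trans x< (+-monoʳ-≤ a (m≤m+n w v))
  merge {x} (inj₂ (a+w≤x , x<)) = ≤-trans (m≤m+n a w) a+w≤x , subst (x <_) (+-assoc a w v) x<

interval-disjoint : ∀ a w v → Interval a w ⊥ Interval (a + w) v
interval-disjoint a w v ((_ , x<a+w) , (a+w≤x , _)) = <⇒≱ x<a+w a+w≤x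

interval-shift : ∀ a {w x} → Interval 0 w x → Interval a w (a + x)
interval-shift a (_ , x<w) = m≤m+n a _ , +-monoʳ-< a x<w

interval-unshift : ∀ a {w y} → Interval a w y → ∃ λ x → Interval 0 w x × a + x ≡ y
interval-unshift a {w} {y} (a≤y , y<a+w) = y ∸ a , (z≤n , y∸a<w) , m+[n∸m]≡n a≤y
  where
  y∸a<w : y ∸ a < w
  y∸a<w = +-cancelˡ-< a _ _ (subst (_< a + w) (sym (m+[n∸m]≡n a≤y)) y<a+w)

rect-splitˣ : ∀ a b w v h → Rect (a , b) (w + v) h ≐ Rect (a , b) w h ∪ Rect (a + w , b) v h
rect-splitˣ a b w v h with split , merge ← interval-split a w v =
  (λ (x∈ , y∈) → Sum.map (_, y∈) (_, y∈) (split x∈)) ,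
  λ { (inj₁ (x∈ , y∈)) → merge (inj₁ x∈) , y∈ ; (inj₂ (x∈ , y∈)) → merge (inj₂ x∈) , y∈ }

rect-splitʸ : ∀ a b w h v → Rect (a , b) w (h + v) ≐ Rect (a , b) w h ∪ Rect (a , b + h) w v
rect-splitʸ a b w h v with split , merge ← interval-split b h v =
  (λ (x∈ , y∈) → Sum.map (x∈ ,_) (x∈ ,_) (split y∈)) ,
  λ { (inj₁ (x∈ , y∈)) → x∈ , merge (inj₁ y∈) ; (inj₂ (x∈ , y∈)) → x∈ , merge (inj₂ y∈) }

rect-disjointˣ : ∀ a b w v h → Rect (a , b) w h ⊥ Rect (a + w , b) v h
rect-disjointˣ a b w v h ((x∈ , _) , (x∈′ , _)) = interval-disjoint a w v (x∈ , x∈′)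

rect-disjointʸ : ∀ a b w h v → Rect (a , b) w h ⊥ Rect (a , b + h) w v
rect-disjointʸ a b w h v ((_ , y∈) , (_ , y∈′)) = interval-disjoint b h v (y∈ , y∈′)

hamPath-⊕ : ∀ o {w h u v} → HamPath Knight (Box w h) u v → HamPath Knight (Rect o w h) (o ⊕ u) (o ⊕ v)
hamPath-⊕ o@(a , b) = hamPath-map Knight (knight-⊕ o) (⊕-injective o)
  (λ (x∈ , y∈) → interval-shift a x∈ , interval-shift b y∈)
  (λ (x∈ , y∈) → let (x , x∈′ , a+x≡) = interval-unshift a x∈
                     (y , y∈′ , b+y≡) = interval-unshift b y∈
                 in (x , y) , (x∈′ , y∈′) , cong₂ _,_ a+x≡ b+y≡)

-- Blocks and their assembly

-- X Y Z and P Q are two Hamiltonian paths of the block, cut into arcs at the moves that are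
-- traded for detours when blocks are merged. A block in the first column uses X Y Z: the move
-- X → Y becomes a detour through the blocks above it, Y → Z one through the blocks to its
-- right. Every other block uses P Q, is entered at (0,2) and left from (2,7) by the detour of
-- its left neighbour, and trades P → Q for a detour through the blocks to its right.
record Block (w h : ℕ) : Set where
  field
    X Y Z  : List Pos
    X-walk : Walk Knight (2 , 0) (0 , h ∸ 5) X
    Y-walk : Walk Knight (5 , h ∸ 3) (w ∸ 5 , 0) Y
    Z-walk : Walk Knight (w ∸ 3 , 5) (7 , 2) Z
    corner : Enumerates (Box w h) (X ++ Y ++ Z)
    inner  : SplitPath Knight (Box w h) (0 , 2) (w ∸ 5 , 0) (w ∸ 3 , 5) (2 , 7)

module Grid (Size : ℕ → Set) (size≥5 : ∀ {w} → Size w → 5 ≤ w)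
            (block : ∀ {w h} → Size w → Size h → Block w h) where

  innerRow : ∀ {h w ws} → Size h → All Size (w ∷ ws) →
             HamPath Knight (Box (sum (w ∷ ws)) h) (0 , 2) (2 , 7)
  innerRow {h} {w} {[]} sh (sw ∷ []) =
    subst (λ W → HamPath Knight (Box W h) (0 , 2) (2 , 7)) (sym (+-identityʳ w))
      (join Knight (knight-cut (size≥5 sw)) (Block.inner (block sw sh)))
  innerRow {h} {w} {_ ∷ _} sh (sw ∷ sws) =
    hamPath-resp-≐ Knight (≐-sym (rect-splitˣ 0 0 w _ h))
      (splice Knight (rect-disjointˣ 0 0 w _ h) (knight-exit (size≥5 sw)) (knight-return (size≥5 sw))
        (Block.inner (block sw sh)) (hamPath-⊕ (w , 0) (innerRow sh sws)))

  boardRow : ∀ {h w ws} → Size h → All Size (w ∷ ws) →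
             SplitPath Knight (Box (sum (w ∷ ws)) h) (2 , 0) (0 , h ∸ 5) (5 , h ∸ 3) (7 , 2)
  boardRow {h} {w} {[]} sh (sw ∷ []) = record
    { front-walk = X-walk
    ; back-walk  = walk-++ Knight Y-walk (knight-cut (size≥5 sw)) Z-walk
    ; enumerates = subst (λ W → Enumerates (Box W h) (X ++ Y ++ Z)) (sym (+-identityʳ w)) corner
    }
    where open Block (block sw sh)
  boardRow {h} {w} {_ ∷ _} sh (sw ∷ sws) = record
    { front-walk = X-walk
    ; back-walk  = walk-++ Knight Y-walk (knight-exit (size≥5 sw))
                     (walk-++ Knight (HamPath.walk rest) (knight-return (size≥5 sw)) Z-walk)
    ; enumerates = enumerates-resp-≐ (≐-sym (rect-splitˣ 0 0 w _ h))
                     (subst (Enumerates _) (++-assoc X Y _)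
                       (enumerates-insert (X ++ Y) (rect-disjointˣ 0 0 w _ h)
                         (subst (Enumerates _) (sym (++-assoc X Y Z)) corner)
                         (HamPath.enumerates rest)))
    }
    where
    open Block (block sw sh)
    rest = hamPath-⊕ (w , 0) (innerRow sh sws)

  -- The vertical seams are the transposes of the horizontal ones.
  board : ∀ {w ws h hs} → All Size (w ∷ ws) → All Size (h ∷ hs) →
          HamPath Knight (Box (sum (w ∷ ws)) (sum (h ∷ hs))) (2 , 0) (7 , 2)
  board {w} {ws} {h} {[]} sws (sh ∷ []) =
    subst (λ H → HamPath Knight (Box (sum (w ∷ ws)) H) (2 , 0) (7 , 2)) (sym (+-identityʳ h))
      (join Knight (knight-swap (knight-cut (size≥5 sh))) (boardRow sh sws))
  board {w} {ws} {h} {_ ∷ _} sws (sh ∷ shs) =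
    hamPath-resp-≐ Knight (≐-sym (rect-splitʸ 0 0 _ h _))
      (splice Knight (rect-disjointʸ 0 0 _ h _)
        (knight-swap (knight-exit (size≥5 sh))) (knight-swap (knight-return (size≥5 sh)))
        (boardRow sh sws) (hamPath-⊕ (0 , h) (board sws shs)))

-- Verifying blocks by evaluation

_==_ : Pos → Pos → Bool
(x , y) == (x′ , y′) = (x ≡ᵇ x′) ∧ (y ≡ᵇ y′)

==-sound : ∀ p q → T (p == q) → p ≡ q
==-sound (x , y) (x′ , y′) t with tx , ty ← to T-∧ t = cong₂ _,_ (≡ᵇ⇒≡ x x′ tx) (≡ᵇ⇒≡ y y′ ty)

==-refl : ∀ p → T (p == p)
==-refl (x , y) = from T-∧ (≡⇒≡ᵇ x x refl , ≡⇒≡ᵇ y y refl)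

knightᵇ : Pos → Pos → Bool
knightᵇ (x , y) (x′ , y′) =
  ((dist x x′ ≡ᵇ 2) ∧ (dist y y′ ≡ᵇ 5)) ∨ ((dist x x′ ≡ᵇ 5) ∧ (dist y y′ ≡ᵇ 2))

knightᵇ-sound : ∀ p q → T (knightᵇ p q) → Knight p q
knightᵇ-sound (x , y) (x′ , y′) t with to T-∨ t
... | inj₁ t₂₅ = let tx , ty = to T-∧ t₂₅ in step₂₅ (≡ᵇ⇒≡ _ 2 tx) (≡ᵇ⇒≡ _ 5 ty)
... | inj₂ t₅₂ = let tx , ty = to T-∧ t₅₂ in step₅₂ (≡ᵇ⇒≡ _ 5 tx) (≡ᵇ⇒≡ _ 2 ty)

linkedᵇ : List Pos → Bool
linkedᵇ (p ∷ q ∷ ps) = knightᵇ p q ∧ linkedᵇ (q ∷ ps)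
linkedᵇ _            = true

linkedᵇ-sound : ∀ ps → T (linkedᵇ ps) → Linked Knight ps
linkedᵇ-sound []           _ = []
linkedᵇ-sound (p ∷ [])     _ = [-]
linkedᵇ-sound (p ∷ q ∷ ps) t =
  knightᵇ-sound p q (proj₁ (to T-∧ t)) ∷ linkedᵇ-sound (q ∷ ps) (proj₂ (to T-∧ t))

isJustᵇ : Pos → Maybe Pos → Bool
isJustᵇ u (just p) = p == u
isJustᵇ u nothing  = false

isJustᵇ-sound : ∀ u m → T (isJustᵇ u m) → m ≡ just u
isJustᵇ-sound u (just p) t = cong just (==-sound p u t)

walkᵇ : Pos → Pos → List Pos → Bool
walkᵇ u v ps = linkedᵇ ps ∧ isJustᵇ u (head ps) ∧ isJustᵇ v (last ps)

walkᵇ-sound : ∀ u v ps → T (walkᵇ u v ps) → Walk Knight u v ps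
walkᵇ-sound u v ps t with tl , tends ← to T-∧ t with th , te ← to T-∧ tends = record
  { linked = linkedᵇ-sound ps tl ; start = isJustᵇ-sound u (head ps) th ; end = isJustᵇ-sound v (last ps) te }

elemᵇ : Pos → List Pos → Bool
elemᵇ p = any (p ==_)

elemᵇ-sound : ∀ p ps → T (elemᵇ p ps) → p ∈ ps
elemᵇ-sound p ps t = Any.map (==-sound p _) (any⁻ (p ==_) ps t)

elemᵇ-complete : ∀ {p ps} → p ∈ ps → T (elemᵇ p ps)
elemᵇ-complete {p} p∈ps = any⁺ (p ==_) (Any.map (λ { refl → ==-refl p }) p∈ps)

uniqueᵇ : List Pos → Bool
uniqueᵇ []       = true
uniqueᵇ (p ∷ ps) = not (elemᵇ p ps) ∧ uniqueᵇ ps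

uniqueᵇ-sound : ∀ ps → T (uniqueᵇ ps) → Unique ps
uniqueᵇ-sound []       _ = []
uniqueᵇ-sound (p ∷ ps) t = ¬Any⇒All¬ ps p∉ps ∷ uniqueᵇ-sound ps (proj₂ (to T-∧ t))
  where
  p∉ps : p ∉ ps
  p∉ps p∈ps = subst T (to T-not-≡ (proj₁ (to T-∧ t))) (elemᵇ-complete p∈ps)

boxᵇ : ℕ → ℕ → Pos → Bool
boxᵇ w h (x , y) = (x <ᵇ w) ∧ (y <ᵇ h)

boxᵇ-sound : ∀ w h p → T (boxᵇ w h p) → Box w h p
boxᵇ-sound w h (x , y) t with tx , ty ← to T-∧ t = (z≤n , <ᵇ⇒< x w tx) , (z≤n , <ᵇ⇒< y h ty)

coversᵇ : ℕ → ℕ → List Pos → Bool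
coversᵇ w h ps = all (λ x → all (λ y → elemᵇ (x , y) ps) (upTo h)) (upTo w)

coversᵇ-sound : ∀ w h ps → T (coversᵇ w h ps) → Box w h ⊆ (_∈ ps)
coversᵇ-sound w h ps t {x , y} ((_ , x<w) , (_ , y<h)) = elemᵇ-sound (x , y) ps
  (All.lookup (all⁺ _ (upTo h) (All.lookup (all⁺ _ (upTo w) t) (∈-upTo⁺ x<w))) (∈-upTo⁺ y<h))

enumeratesBoxᵇ : ℕ → ℕ → List Pos → Bool
enumeratesBoxᵇ w h ps = uniqueᵇ ps ∧ all (boxᵇ w h) ps ∧ coversᵇ w h ps

enumeratesBoxᵇ-sound : ∀ w h ps → T (enumeratesBoxᵇ w h ps) → Enumerates (Box w h) ps
enumeratesBoxᵇ-sound w h ps t with tu , tsc ← to T-∧ t with ts , tc ← to T-∧ tsc = record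
  { unique   = uniqueᵇ-sound ps tu
  ; sound    = All.map (boxᵇ-sound w h _) (all⁺ _ ps ts)
  ; complete = coversᵇ-sound w h ps tc
  }

-- Both traversals of a block are cut out of one Hamiltonian cycle C of the box: X Y Z are
-- consecutive arcs of C, and P Q of C rotated by rot. The implicit arguments have types
-- T b for closed booleans b, so they are filled in by evaluation exactly when the checks pass.
module _ {w h : ℕ} (C : List Pos) (lenX lenY rot lenP : ℕ) where

  private
    X Y Z rotated P Q : List Pos
    X = take lenX C
    Y = take lenY (drop lenX C)
    Z = drop lenY (drop lenX C)
    rotated = drop rot C ++ take rot C
    P = take lenP rotated
    Q = drop lenP rotated

    XYZ≡C : X ++ Y ++ Z ≡ C
    XYZ≡C = trans (cong (X ++_) (take++drop≡id lenY (drop lenX C))) (take++drop≡id lenX C)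

    C↭rotated : C ↭ rotated
    C↭rotated = ↭-trans (↭-reflexive (sym (take++drop≡id rot C))) (++-comm (take rot C) (drop rot C))

  cutBlock : {_ : T (enumeratesBoxᵇ w h C)} →
             {_ : T (walkᵇ (2 , 0) (0 , h ∸ 5) X)} →
             {_ : T (walkᵇ (5 , h ∸ 3) (w ∸ 5 , 0) Y)} →
             {_ : T (walkᵇ (w ∸ 3 , 5) (7 , 2) Z)} →
             {_ : T (walkᵇ (0 , 2) (w ∸ 5 , 0) P)} →
             {_ : T (walkᵇ (w ∸ 3 , 5) (2 , 7) Q)} →
             Block w h
  cutBlock {okC} {okX} {okY} {okZ} {okP} {okQ} = record
    { X-walk = walkᵇ-sound _ _ X okX
    ; Y-walk = walkᵇ-sound _ _ Y okY
    ; Z-walk = walkᵇ-sound _ _ Z okZ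
    ; corner = subst (Enumerates _) (sym XYZ≡C) C-enumerates
    ; inner  = record
      { front-walk = walkᵇ-sound _ _ P okP
      ; back-walk  = walkᵇ-sound _ _ Q okQ
      ; enumerates = subst (Enumerates _) (sym (take++drop≡id lenP rotated))
                       (enumerates-resp-↭ C↭rotated C-enumerates)
      }
    }
    where
    C-enumerates : Enumerates (Box w h) C
    C-enumerates = enumeratesBoxᵇ-sound w h C okC

cycle14×14 : List Pos
cycle14×14 =
  (2 , 0) ∷ (0 , 5) ∷ (5 , 7) ∷ (0 , 9) ∷ (5 , 11) ∷ (0 , 13) ∷ (2 , 8) ∷ (0 , 3) ∷ (5 , 1) ∷ (10 , 3) ∷ (12 , 8) ∷ (10 , 13) ∷
  (8 , 8) ∷ (13 , 10) ∷ (8 , 12) ∷ (10 , 7) ∷ (12 , 12) ∷ (7 , 10) ∷ (2 , 12) ∷ (0 , 7) ∷ (2 , 2) ∷ (4 , 7) ∷ (9 , 9) ∷ (11 , 4) ∷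
  (13 , 9) ∷ (8 , 7) ∷ (10 , 12) ∷ (5 , 10) ∷ (0 , 12) ∷ (2 , 7) ∷ (0 , 2) ∷ (5 , 0) ∷ (7 , 5) ∷ (9 , 10) ∷ (4 , 12) ∷ (6 , 7) ∷
  (4 , 2) ∷ (9 , 0) ∷ (11 , 5) ∷ (13 , 0) ∷ (8 , 2) ∷ (3 , 0) ∷ (5 , 5) ∷ (3 , 10) ∷ (1 , 5) ∷ (6 , 3) ∷ (1 , 1) ∷ (3 , 6) ∷
  (1 , 11) ∷ (6 , 13) ∷ (4 , 8) ∷ (2 , 13) ∷ (0 , 8) ∷ (2 , 3) ∷ (7 , 1) ∷ (12 , 3) ∷ (10 , 8) ∷ (12 , 13) ∷ (7 , 11) ∷ (12 , 9) ∷
  (10 , 4) ∷ (5 , 6) ∷ (0 , 4) ∷ (2 , 9) ∷ (7 , 7) ∷ (9 , 12) ∷ (4 , 10) ∷ (2 , 5) ∷ (0 , 0) ∷ (5 , 2) ∷ (3 , 7) ∷ (1 , 12) ∷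
  (6 , 10) ∷ (11 , 12) ∷ (13 , 7) ∷ (8 , 9) ∷ (13 , 11) ∷ (8 , 13) ∷ (3 , 11) ∷ (1 , 6) ∷ (3 , 1) ∷ (8 , 3) ∷ (13 , 1) ∷ (11 , 6) ∷
  (9 , 1) ∷ (4 , 3) ∷ (6 , 8) ∷ (4 , 13) ∷ (9 , 11) ∷ (4 , 9) ∷ (2 , 4) ∷ (7 , 6) ∷ (12 , 4) ∷ (10 , 9) ∷ (8 , 4) ∷ (13 , 2) ∷
  (8 , 0) ∷ (3 , 2) ∷ (1 , 7) ∷ (3 , 12) ∷ (8 , 10) ∷ (13 , 12) ∷ (11 , 7) ∷ (6 , 9) ∷ (11 , 11) ∷ (13 , 6) ∷ (11 , 1) ∷ (9 , 6) ∷
  (4 , 4) ∷ (9 , 2) ∷ (4 , 0) ∷ (6 , 5) ∷ (1 , 3) ∷ (6 , 1) ∷ (11 , 3) ∷ (13 , 8) ∷ (11 , 13) ∷ (9 , 8) ∷ (4 , 6) ∷ (9 , 4) ∷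
  (11 , 9) ∷ (13 , 4) ∷ (8 , 6) ∷ (3 , 4) ∷ (1 , 9) ∷ (6 , 11) ∷ (1 , 13) ∷ (3 , 8) ∷ (5 , 13) ∷ (10 , 11) ∷ (5 , 9) ∷ (0 , 11) ∷
  (2 , 6) ∷ (0 , 1) ∷ (5 , 3) ∷ (10 , 1) ∷ (12 , 6) ∷ (7 , 4) ∷ (12 , 2) ∷ (7 , 0) ∷ (9 , 5) ∷ (11 , 0) ∷ (13 , 5) ∷ (11 , 10) ∷
  (6 , 12) ∷ (1 , 10) ∷ (3 , 5) ∷ (1 , 0) ∷ (6 , 2) ∷ (1 , 4) ∷ (3 , 9) ∷ (5 , 4) ∷ (10 , 2) ∷ (12 , 7) ∷ (7 , 9) ∷ (2 , 11) ∷
  (7 , 13) ∷ (12 , 11) ∷ (10 , 6) ∷ (12 , 1) ∷ (7 , 3) ∷ (2 , 1) ∷ (0 , 6) ∷ (5 , 8) ∷ (0 , 10) ∷ (5 , 12) ∷ (10 , 10) ∷ (12 , 5) ∷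
  (10 , 0) ∷ (8 , 5) ∷ (13 , 3) ∷ (8 , 1) ∷ (3 , 3) ∷ (1 , 8) ∷ (3 , 13) ∷ (8 , 11) ∷ (13 , 13) ∷ (11 , 8) ∷ (9 , 13) ∷ (4 , 11) ∷
  (6 , 6) ∷ (4 , 1) ∷ (9 , 3) ∷ (4 , 5) ∷ (6 , 0) ∷ (1 , 2) ∷ (6 , 4) ∷ (11 , 2) ∷ (9 , 7) ∷ (7 , 12) ∷ (2 , 10) ∷ (7 , 8) ∷
  (12 , 10) ∷ (10 , 5) ∷ (12 , 0) ∷ (7 , 2) ∷ []

cycle14×20 : List Pos
cycle14×20 =
  (2 , 0) ∷ (0 , 5) ∷ (2 , 10) ∷ (0 , 15) ∷ (5 , 17) ∷ (0 , 19) ∷ (2 , 14) ∷ (4 , 19) ∷ (6 , 14) ∷ (4 , 9) ∷ (2 , 4) ∷ (0 , 9) ∷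
  (5 , 11) ∷ (10 , 13) ∷ (12 , 18) ∷ (7 , 16) ∷ (12 , 14) ∷ (10 , 19) ∷ (8 , 14) ∷ (13 , 12) ∷ (11 , 7) ∷ (9 , 12) ∷ (4 , 10) ∷ (2 , 15) ∷
  (0 , 10) ∷ (5 , 12) ∷ (7 , 7) ∷ (9 , 2) ∷ (4 , 4) ∷ (2 , 9) ∷ (0 , 14) ∷ (2 , 19) ∷ (4 , 14) ∷ (6 , 19) ∷ (11 , 17) ∷ (6 , 15) ∷
  (1 , 17) ∷ (3 , 12) ∷ (5 , 7) ∷ (10 , 9) ∷ (12 , 4) ∷ (7 , 6) ∷ (5 , 1) ∷ (3 , 6) ∷ (1 , 1) ∷ (6 , 3) ∷ (11 , 1) ∷ (9 , 6) ∷
  (7 , 1) ∷ (12 , 3) ∷ (10 , 8) ∷ (12 , 13) ∷ (10 , 18) ∷ (5 , 16) ∷ (0 , 18) ∷ (2 , 13) ∷ (0 , 8) ∷ (5 , 10) ∷ (3 , 15) ∷ (1 , 10) ∷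
  (6 , 8) ∷ (4 , 3) ∷ (9 , 1) ∷ (11 , 6) ∷ (13 , 1) ∷ (8 , 3) ∷ (3 , 1) ∷ (1 , 6) ∷ (3 , 11) ∷ (1 , 16) ∷ (6 , 18) ∷ (8 , 13) ∷
  (13 , 11) ∷ (11 , 16) ∷ (9 , 11) ∷ (4 , 13) ∷ (2 , 18) ∷ (0 , 13) ∷ (2 , 8) ∷ (0 , 3) ∷ (5 , 5) ∷ (3 , 0) ∷ (1 , 5) ∷ (3 , 10) ∷
  (1 , 15) ∷ (6 , 13) ∷ (4 , 18) ∷ (9 , 16) ∷ (7 , 11) ∷ (12 , 9) ∷ (10 , 4) ∷ (5 , 6) ∷ (0 , 4) ∷ (5 , 2) ∷ (0 , 0) ∷ (2 , 5) ∷
  (4 , 0) ∷ (6 , 5) ∷ (11 , 3) ∷ (9 , 8) ∷ (4 , 6) ∷ (6 , 11) ∷ (4 , 16) ∷ (9 , 18) ∷ (7 , 13) ∷ (2 , 11) ∷ (0 , 16) ∷ (5 , 18) ∷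
  (10 , 16) ∷ (12 , 11) ∷ (7 , 9) ∷ (12 , 7) ∷ (10 , 12) ∷ (8 , 7) ∷ (3 , 5) ∷ (1 , 0) ∷ (6 , 2) ∷ (1 , 4) ∷ (3 , 9) ∷ (8 , 11) ∷
  (13 , 9) ∷ (11 , 4) ∷ (9 , 9) ∷ (4 , 7) ∷ (9 , 5) ∷ (11 , 0) ∷ (13 , 5) ∷ (11 , 10) ∷ (13 , 15) ∷ (8 , 17) ∷ (13 , 19) ∷ (11 , 14) ∷
  (9 , 19) ∷ (7 , 14) ∷ (5 , 19) ∷ (3 , 14) ∷ (1 , 19) ∷ (6 , 17) ∷ (11 , 15) ∷ (13 , 10) ∷ (8 , 12) ∷ (13 , 14) ∷ (11 , 19) ∷ (9 , 14) ∷
  (7 , 19) ∷ (12 , 17) ∷ (7 , 15) ∷ (9 , 10) ∷ (4 , 8) ∷ (2 , 3) ∷ (7 , 5) ∷ (9 , 0) ∷ (11 , 5) ∷ (13 , 0) ∷ (8 , 2) ∷ (13 , 4) ∷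
  (11 , 9) ∷ (9 , 4) ∷ (4 , 2) ∷ (2 , 7) ∷ (0 , 2) ∷ (5 , 0) ∷ (10 , 2) ∷ (5 , 4) ∷ (0 , 6) ∷ (2 , 1) ∷ (7 , 3) ∷ (12 , 1) ∷
  (10 , 6) ∷ (5 , 8) ∷ (3 , 3) ∷ (8 , 5) ∷ (10 , 0) ∷ (12 , 5) ∷ (10 , 10) ∷ (12 , 15) ∷ (7 , 17) ∷ (12 , 19) ∷ (10 , 14) ∷ (8 , 19) ∷
  (13 , 17) ∷ (8 , 15) ∷ (3 , 17) ∷ (1 , 12) ∷ (3 , 7) ∷ (1 , 2) ∷ (6 , 4) ∷ (8 , 9) ∷ (13 , 7) ∷ (11 , 12) ∷ (9 , 17) ∷ (4 , 15) ∷
  (6 , 10) ∷ (1 , 8) ∷ (3 , 13) ∷ (1 , 18) ∷ (6 , 16) ∷ (4 , 11) ∷ (2 , 16) ∷ (0 , 11) ∷ (5 , 13) ∷ (10 , 11) ∷ (12 , 16) ∷ (7 , 18) ∷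
  (9 , 13) ∷ (11 , 18) ∷ (13 , 13) ∷ (11 , 8) ∷ (13 , 3) ∷ (8 , 1) ∷ (6 , 6) ∷ (4 , 1) ∷ (2 , 6) ∷ (0 , 1) ∷ (5 , 3) ∷ (10 , 1) ∷
  (8 , 6) ∷ (6 , 1) ∷ (1 , 3) ∷ (3 , 8) ∷ (1 , 13) ∷ (3 , 18) ∷ (8 , 16) ∷ (13 , 18) ∷ (11 , 13) ∷ (13 , 8) ∷ (8 , 10) ∷ (10 , 15) ∷
  (12 , 10) ∷ (7 , 12) ∷ (9 , 7) ∷ (11 , 2) ∷ (6 , 0) ∷ (4 , 5) ∷ (9 , 3) ∷ (7 , 8) ∷ (12 , 6) ∷ (7 , 4) ∷ (12 , 2) ∷ (7 , 0) ∷
  (2 , 2) ∷ (0 , 7) ∷ (2 , 12) ∷ (0 , 17) ∷ (5 , 15) ∷ (10 , 17) ∷ (12 , 12) ∷ (10 , 7) ∷ (5 , 9) ∷ (3 , 4) ∷ (1 , 9) ∷ (6 , 7) ∷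
  (4 , 12) ∷ (2 , 17) ∷ (0 , 12) ∷ (5 , 14) ∷ (3 , 19) ∷ (1 , 14) ∷ (6 , 12) ∷ (4 , 17) ∷ (9 , 15) ∷ (7 , 10) ∷ (12 , 8) ∷ (10 , 3) ∷
  (8 , 8) ∷ (13 , 6) ∷ (11 , 11) ∷ (13 , 16) ∷ (8 , 18) ∷ (3 , 16) ∷ (1 , 11) ∷ (6 , 9) ∷ (1 , 7) ∷ (3 , 2) ∷ (8 , 4) ∷ (13 , 2) ∷
  (8 , 0) ∷ (10 , 5) ∷ (12 , 0) ∷ (7 , 2) ∷ []

cycle20×14 : List Pos
cycle20×14 =
  (2 , 0) ∷ (4 , 5) ∷ (2 , 10) ∷ (0 , 5) ∷ (5 , 3) ∷ (0 , 1) ∷ (2 , 6) ∷ (4 , 11) ∷ (9 , 13) ∷ (14 , 11) ∷ (19 , 13) ∷ (17 , 8) ∷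
  (15 , 13) ∷ (10 , 11) ∷ (8 , 6) ∷ (10 , 1) ∷ (15 , 3) ∷ (10 , 5) ∷ (8 , 0) ∷ (6 , 5) ∷ (4 , 0) ∷ (9 , 2) ∷ (11 , 7) ∷ (16 , 9) ∷
  (18 , 4) ∷ (13 , 2) ∷ (18 , 0) ∷ (16 , 5) ∷ (18 , 10) ∷ (13 , 12) ∷ (8 , 10) ∷ (3 , 12) ∷ (1 , 7) ∷ (6 , 9) ∷ (4 , 4) ∷ (2 , 9) ∷
  (0 , 4) ∷ (5 , 2) ∷ (0 , 0) ∷ (2 , 5) ∷ (4 , 10) ∷ (9 , 12) ∷ (14 , 10) ∷ (19 , 12) ∷ (17 , 7) ∷ (19 , 2) ∷ (14 , 0) ∷ (12 , 5) ∷
  (7 , 7) ∷ (12 , 9) ∷ (17 , 11) ∷ (19 , 6) ∷ (14 , 4) ∷ (9 , 6) ∷ (11 , 1) ∷ (13 , 6) ∷ (15 , 1) ∷ (10 , 3) ∷ (8 , 8) ∷ (10 , 13) ∷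
  (15 , 11) ∷ (17 , 6) ∷ (19 , 1) ∷ (14 , 3) ∷ (19 , 5) ∷ (17 , 10) ∷ (12 , 12) ∷ (7 , 10) ∷ (12 , 8) ∷ (14 , 13) ∷ (19 , 11) ∷ (14 , 9) ∷
  (12 , 4) ∷ (17 , 2) ∷ (19 , 7) ∷ (17 , 12) ∷ (15 , 7) ∷ (10 , 9) ∷ (8 , 4) ∷ (3 , 2) ∷ (5 , 7) ∷ (0 , 9) ∷ (5 , 11) ∷ (0 , 13) ∷
  (2 , 8) ∷ (0 , 3) ∷ (5 , 1) ∷ (7 , 6) ∷ (2 , 4) ∷ (4 , 9) ∷ (6 , 4) ∷ (1 , 6) ∷ (3 , 1) ∷ (5 , 6) ∷ (7 , 1) ∷ (2 , 3) ∷
  (4 , 8) ∷ (9 , 10) ∷ (4 , 12) ∷ (6 , 7) ∷ (4 , 2) ∷ (9 , 0) ∷ (7 , 5) ∷ (5 , 0) ∷ (10 , 2) ∷ (15 , 0) ∷ (17 , 5) ∷ (19 , 0) ∷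
  (14 , 2) ∷ (12 , 7) ∷ (14 , 12) ∷ (19 , 10) ∷ (14 , 8) ∷ (16 , 3) ∷ (18 , 8) ∷ (16 , 13) ∷ (11 , 11) ∷ (6 , 13) ∷ (1 , 11) ∷ (3 , 6) ∷
  (1 , 1) ∷ (6 , 3) ∷ (1 , 5) ∷ (3 , 10) ∷ (8 , 12) ∷ (10 , 7) ∷ (15 , 9) ∷ (17 , 4) ∷ (19 , 9) ∷ (14 , 7) ∷ (16 , 2) ∷ (11 , 0) ∷
  (9 , 5) ∷ (4 , 3) ∷ (9 , 1) ∷ (11 , 6) ∷ (9 , 11) ∷ (4 , 13) ∷ (6 , 8) ∷ (8 , 13) ∷ (3 , 11) ∷ (8 , 9) ∷ (10 , 4) ∷ (15 , 6) ∷
  (17 , 1) ∷ (12 , 3) ∷ (10 , 8) ∷ (12 , 13) ∷ (7 , 11) ∷ (2 , 13) ∷ (0 , 8) ∷ (5 , 10) ∷ (0 , 12) ∷ (2 , 7) ∷ (0 , 2) ∷ (5 , 4) ∷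
  (7 , 9) ∷ (2 , 11) ∷ (0 , 6) ∷ (2 , 1) ∷ (7 , 3) ∷ (12 , 1) ∷ (17 , 3) ∷ (19 , 8) ∷ (17 , 13) ∷ (12 , 11) ∷ (7 , 13) ∷ (5 , 8) ∷
  (0 , 10) ∷ (5 , 12) ∷ (10 , 10) ∷ (15 , 12) ∷ (13 , 7) ∷ (15 , 2) ∷ (10 , 0) ∷ (8 , 5) ∷ (6 , 0) ∷ (1 , 2) ∷ (3 , 7) ∷ (1 , 12) ∷
  (6 , 10) ∷ (11 , 12) ∷ (9 , 7) ∷ (7 , 12) ∷ (12 , 10) ∷ (7 , 8) ∷ (5 , 13) ∷ (0 , 11) ∷ (5 , 9) ∷ (3 , 4) ∷ (1 , 9) ∷ (6 , 11) ∷
  (1 , 13) ∷ (3 , 8) ∷ (1 , 3) ∷ (6 , 1) ∷ (4 , 6) ∷ (9 , 4) ∷ (11 , 9) ∷ (16 , 11) ∷ (18 , 6) ∷ (13 , 8) ∷ (11 , 13) ∷ (9 , 8) ∷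
  (11 , 3) ∷ (16 , 1) ∷ (14 , 6) ∷ (19 , 4) ∷ (17 , 9) ∷ (15 , 4) ∷ (10 , 6) ∷ (15 , 8) ∷ (13 , 3) ∷ (18 , 1) ∷ (16 , 6) ∷ (18 , 11) ∷
  (13 , 13) ∷ (8 , 11) ∷ (3 , 13) ∷ (1 , 8) ∷ (3 , 3) ∷ (8 , 1) ∷ (6 , 6) ∷ (4 , 1) ∷ (9 , 3) ∷ (11 , 8) ∷ (16 , 10) ∷ (18 , 5) ∷
  (16 , 0) ∷ (11 , 2) ∷ (16 , 4) ∷ (18 , 9) ∷ (13 , 11) ∷ (18 , 13) ∷ (16 , 8) ∷ (18 , 3) ∷ (13 , 1) ∷ (8 , 3) ∷ (13 , 5) ∷ (15 , 10) ∷
  (10 , 12) ∷ (8 , 7) ∷ (3 , 9) ∷ (1 , 4) ∷ (6 , 2) ∷ (1 , 0) ∷ (3 , 5) ∷ (1 , 10) ∷ (6 , 12) ∷ (11 , 10) ∷ (16 , 12) ∷ (18 , 7) ∷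
  (13 , 9) ∷ (11 , 4) ∷ (9 , 9) ∷ (4 , 7) ∷ (2 , 12) ∷ (0 , 7) ∷ (2 , 2) ∷ (7 , 0) ∷ (5 , 5) ∷ (3 , 0) ∷ (8 , 2) ∷ (13 , 4) ∷
  (18 , 2) ∷ (16 , 7) ∷ (18 , 12) ∷ (13 , 10) ∷ (11 , 5) ∷ (13 , 0) ∷ (15 , 5) ∷ (17 , 0) ∷ (12 , 2) ∷ (7 , 4) ∷ (12 , 6) ∷ (14 , 1) ∷
  (19 , 3) ∷ (14 , 5) ∷ (12 , 0) ∷ (7 , 2) ∷ []

cycle20×20 : List Pos
cycle20×20 =
  (2 , 0) ∷ (4 , 5) ∷ (2 , 10) ∷ (0 , 15) ∷ (5 , 17) ∷ (0 , 19) ∷ (2 , 14) ∷ (4 , 19) ∷ (9 , 17) ∷ (4 , 15) ∷ (9 , 13) ∷ (11 , 8) ∷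
  (6 , 10) ∷ (1 , 8) ∷ (3 , 13) ∷ (1 , 18) ∷ (6 , 16) ∷ (11 , 18) ∷ (16 , 16) ∷ (18 , 11) ∷ (13 , 9) ∷ (11 , 4) ∷ (9 , 9) ∷ (11 , 14) ∷
  (9 , 19) ∷ (7 , 14) ∷ (5 , 19) ∷ (0 , 17) ∷ (5 , 15) ∷ (0 , 13) ∷ (2 , 18) ∷ (4 , 13) ∷ (2 , 8) ∷ (0 , 3) ∷ (5 , 1) ∷ (3 , 6) ∷
  (1 , 1) ∷ (6 , 3) ∷ (1 , 5) ∷ (3 , 10) ∷ (1 , 15) ∷ (6 , 17) ∷ (1 , 19) ∷ (3 , 14) ∷ (1 , 9) ∷ (3 , 4) ∷ (5 , 9) ∷ (0 , 11) ∷
  (5 , 13) ∷ (7 , 8) ∷ (12 , 6) ∷ (14 , 11) ∷ (19 , 9) ∷ (17 , 4) ∷ (15 , 9) ∷ (10 , 11) ∷ (15 , 13) ∷ (17 , 18) ∷ (12 , 16) ∷ (7 , 18) ∷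
  (2 , 16) ∷ (4 , 11) ∷ (2 , 6) ∷ (0 , 1) ∷ (5 , 3) ∷ (0 , 5) ∷ (5 , 7) ∷ (7 , 12) ∷ (9 , 7) ∷ (11 , 12) ∷ (16 , 14) ∷ (18 , 19) ∷
  (13 , 17) ∷ (18 , 15) ∷ (16 , 10) ∷ (18 , 5) ∷ (13 , 7) ∷ (15 , 2) ∷ (10 , 0) ∷ (8 , 5) ∷ (3 , 3) ∷ (8 , 1) ∷ (13 , 3) ∷ (18 , 1) ∷
  (16 , 6) ∷ (14 , 1) ∷ (9 , 3) ∷ (4 , 1) ∷ (6 , 6) ∷ (1 , 4) ∷ (6 , 2) ∷ (1 , 0) ∷ (3 , 5) ∷ (5 , 0) ∷ (10 , 2) ∷ (15 , 0) ∷
  (17 , 5) ∷ (19 , 0) ∷ (14 , 2) ∷ (9 , 0) ∷ (11 , 5) ∷ (13 , 0) ∷ (8 , 2) ∷ (3 , 0) ∷ (5 , 5) ∷ (0 , 7) ∷ (2 , 2) ∷ (7 , 4) ∷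
  (12 , 2) ∷ (7 , 0) ∷ (9 , 5) ∷ (4 , 7) ∷ (2 , 12) ∷ (4 , 17) ∷ (9 , 15) ∷ (7 , 10) ∷ (12 , 8) ∷ (10 , 3) ∷ (8 , 8) ∷ (13 , 10) ∷
  (15 , 15) ∷ (10 , 17) ∷ (15 , 19) ∷ (17 , 14) ∷ (19 , 19) ∷ (14 , 17) ∷ (19 , 15) ∷ (17 , 10) ∷ (12 , 12) ∷ (14 , 7) ∷ (19 , 5) ∷ (17 , 0) ∷
  (15 , 5) ∷ (10 , 7) ∷ (8 , 12) ∷ (13 , 14) ∷ (11 , 19) ∷ (9 , 14) ∷ (4 , 12) ∷ (6 , 7) ∷ (4 , 2) ∷ (2 , 7) ∷ (0 , 2) ∷ (5 , 4) ∷
  (7 , 9) ∷ (9 , 4) ∷ (4 , 6) ∷ (2 , 1) ∷ (7 , 3) ∷ (12 , 5) ∷ (14 , 0) ∷ (19 , 2) ∷ (17 , 7) ∷ (19 , 12) ∷ (14 , 10) ∷ (12 , 15) ∷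
  (7 , 17) ∷ (2 , 19) ∷ (0 , 14) ∷ (5 , 12) ∷ (7 , 7) ∷ (9 , 12) ∷ (4 , 14) ∷ (6 , 19) ∷ (1 , 17) ∷ (3 , 12) ∷ (8 , 14) ∷ (10 , 19) ∷
  (15 , 17) ∷ (10 , 15) ∷ (8 , 10) ∷ (3 , 8) ∷ (1 , 3) ∷ (6 , 1) ∷ (11 , 3) ∷ (9 , 8) ∷ (11 , 13) ∷ (9 , 18) ∷ (4 , 16) ∷ (2 , 11) ∷
  (0 , 6) ∷ (5 , 8) ∷ (0 , 10) ∷ (2 , 15) ∷ (4 , 10) ∷ (6 , 15) ∷ (11 , 17) ∷ (16 , 15) ∷ (18 , 10) ∷ (16 , 5) ∷ (18 , 0) ∷ (13 , 2) ∷
  (18 , 4) ∷ (16 , 9) ∷ (14 , 4) ∷ (12 , 9) ∷ (7 , 11) ∷ (5 , 16) ∷ (0 , 18) ∷ (2 , 13) ∷ (0 , 8) ∷ (5 , 10) ∷ (7 , 15) ∷ (12 , 17) ∷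
  (7 , 19) ∷ (2 , 17) ∷ (0 , 12) ∷ (5 , 14) ∷ (0 , 16) ∷ (5 , 18) ∷ (7 , 13) ∷ (12 , 11) ∷ (14 , 16) ∷ (19 , 18) ∷ (17 , 13) ∷ (19 , 8) ∷
  (17 , 3) ∷ (12 , 1) ∷ (10 , 6) ∷ (15 , 4) ∷ (17 , 9) ∷ (19 , 4) ∷ (14 , 6) ∷ (16 , 1) ∷ (18 , 6) ∷ (13 , 8) ∷ (15 , 3) ∷ (10 , 1) ∷
  (8 , 6) ∷ (6 , 11) ∷ (1 , 13) ∷ (3 , 18) ∷ (8 , 16) ∷ (13 , 18) ∷ (18 , 16) ∷ (16 , 11) ∷ (11 , 9) ∷ (13 , 4) ∷ (18 , 2) ∷ (16 , 7) ∷
  (18 , 12) ∷ (16 , 17) ∷ (11 , 15) ∷ (9 , 10) ∷ (4 , 8) ∷ (9 , 6) ∷ (7 , 1) ∷ (2 , 3) ∷ (7 , 5) ∷ (12 , 3) ∷ (17 , 1) ∷ (19 , 6) ∷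
  (17 , 11) ∷ (19 , 16) ∷ (14 , 18) ∷ (12 , 13) ∷ (14 , 8) ∷ (19 , 10) ∷ (17 , 15) ∷ (15 , 10) ∷ (13 , 15) ∷ (11 , 10) ∷ (16 , 8) ∷ (18 , 13) ∷
  (16 , 18) ∷ (11 , 16) ∷ (13 , 11) ∷ (18 , 9) ∷ (16 , 4) ∷ (11 , 6) ∷ (9 , 11) ∷ (4 , 9) ∷ (6 , 4) ∷ (1 , 6) ∷ (3 , 1) ∷ (5 , 6) ∷
  (0 , 4) ∷ (2 , 9) ∷ (4 , 4) ∷ (9 , 2) ∷ (4 , 0) ∷ (2 , 5) ∷ (0 , 0) ∷ (5 , 2) ∷ (10 , 4) ∷ (8 , 9) ∷ (3 , 11) ∷ (1 , 16) ∷
  (6 , 18) ∷ (8 , 13) ∷ (10 , 18) ∷ (15 , 16) ∷ (10 , 14) ∷ (15 , 12) ∷ (17 , 17) ∷ (12 , 19) ∷ (14 , 14) ∷ (16 , 19) ∷ (18 , 14) ∷ (13 , 12) ∷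
  (11 , 7) ∷ (6 , 5) ∷ (8 , 0) ∷ (3 , 2) ∷ (1 , 7) ∷ (6 , 9) ∷ (8 , 4) ∷ (10 , 9) ∷ (12 , 4) ∷ (7 , 6) ∷ (2 , 4) ∷ (0 , 9) ∷
  (5 , 11) ∷ (7 , 16) ∷ (12 , 18) ∷ (14 , 13) ∷ (19 , 11) ∷ (14 , 9) ∷ (19 , 7) ∷ (17 , 12) ∷ (19 , 17) ∷ (14 , 19) ∷ (12 , 14) ∷ (17 , 16) ∷
  (15 , 11) ∷ (10 , 13) ∷ (8 , 18) ∷ (3 , 16) ∷ (1 , 11) ∷ (6 , 13) ∷ (4 , 18) ∷ (9 , 16) ∷ (11 , 11) ∷ (13 , 16) ∷ (18 , 18) ∷ (16 , 13) ∷
  (18 , 8) ∷ (16 , 3) ∷ (11 , 1) ∷ (13 , 6) ∷ (15 , 1) ∷ (17 , 6) ∷ (19 , 1) ∷ (14 , 3) ∷ (9 , 1) ∷ (4 , 3) ∷ (6 , 8) ∷ (8 , 3) ∷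
  (10 , 8) ∷ (15 , 6) ∷ (13 , 1) ∷ (18 , 3) ∷ (13 , 5) ∷ (11 , 0) ∷ (16 , 2) ∷ (18 , 7) ∷ (16 , 12) ∷ (18 , 17) ∷ (13 , 19) ∷ (15 , 14) ∷
  (17 , 19) ∷ (19 , 14) ∷ (14 , 12) ∷ (12 , 7) ∷ (10 , 12) ∷ (8 , 7) ∷ (6 , 12) ∷ (1 , 10) ∷ (3 , 15) ∷ (8 , 17) ∷ (3 , 19) ∷ (1 , 14) ∷
  (3 , 9) ∷ (8 , 11) ∷ (10 , 16) ∷ (15 , 18) ∷ (13 , 13) ∷ (15 , 8) ∷ (10 , 10) ∷ (8 , 15) ∷ (3 , 17) ∷ (8 , 19) ∷ (6 , 14) ∷ (1 , 12) ∷
  (3 , 7) ∷ (1 , 2) ∷ (6 , 0) ∷ (11 , 2) ∷ (16 , 0) ∷ (14 , 5) ∷ (19 , 3) ∷ (17 , 8) ∷ (19 , 13) ∷ (14 , 15) ∷ (12 , 10) ∷ (10 , 5) ∷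
  (15 , 7) ∷ (17 , 2) ∷ (12 , 0) ∷ (7 , 2) ∷ []

data Size : ℕ → Set where
  fourteen : Size 14
  twenty   : Size 20

size≥5 : ∀ {w} → Size w → 5 ≤ w
size≥5 fourteen = m≤m+n 5 9
size≥5 twenty   = m≤m+n 5 15

block : ∀ {w h} → Size w → Size h → Block w h
block fourteen fourteen = cutBlock cycle14×14 4 34 30 8
block fourteen twenty   = cutBlock cycle14×20 4 148 160 272
block twenty   fourteen = cutBlock cycle20×14 82 24 154 232
block twenty   twenty   = cutBlock cycle20×20 4 92 142 354

sizesSummingTo : ∀ m → ∃₂ λ w ws → All Size (w ∷ ws) × sum (w ∷ ws) ≡ (54 + m) * 2
sizesSummingTo 0 = _ , _ , fourteen ∷ fourteen ∷ twenty ∷ twenty ∷ twenty ∷ twenty ∷ [] , refl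
sizesSummingTo 1 = _ , _ , fourteen ∷ fourteen ∷ fourteen ∷ fourteen ∷ fourteen ∷ twenty ∷ twenty ∷ [] , refl
sizesSummingTo 2 = _ , _ , fourteen ∷ fourteen ∷ fourteen ∷ fourteen ∷ fourteen ∷ fourteen ∷ fourteen ∷ fourteen ∷ [] , refl
sizesSummingTo 3 = _ , _ , fourteen ∷ twenty ∷ twenty ∷ twenty ∷ twenty ∷ twenty ∷ [] , refl
sizesSummingTo 4 = _ , _ , fourteen ∷ fourteen ∷ fourteen ∷ fourteen ∷ twenty ∷ twenty ∷ twenty ∷ [] , refl
sizesSummingTo 5 = _ , _ , fourteen ∷ fourteen ∷ fourteen ∷ fourteen ∷ fourteen ∷ fourteen ∷ fourteen ∷ twenty ∷ [] , refl
sizesSummingTo 6 = _ , _ , twenty ∷ twenty ∷ twenty ∷ twenty ∷ twenty ∷ twenty ∷ [] , refl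
sizesSummingTo (suc (suc (suc (suc (suc (suc (suc m))))))) with _ , _ , sizes , sum≡ ← sizesSummingTo m =
  _ , _ , fourteen ∷ sizes , cong (14 +_) sum≡

-- From a Hamiltonian path of the board to a knight's tour

lookup-injective : ∀ {A : Set} {xs : List A} → Unique xs → Injective _≡_ _≡_ (lookup xs)
lookup-injective (_    ∷ u) {zero}  {zero}  _  = refl
lookup-injective (x∉xs ∷ _) {zero}  {suc j} eq = contradiction eq (All.lookup x∉xs (∈-lookup j))
lookup-injective (x∉xs ∷ _) {suc i} {zero}  eq = contradiction (sym eq) (All.lookup x∉xs (∈-lookup i))
lookup-injective (_    ∷ u) {suc i} {suc j} eq = cong suc (lookup-injective u eq)

linked-lookup : ∀ {A : Set} {R : Rel A 0ℓ} {xs} → Linked R xs →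
                ∀ {i j : Fin (length xs)} → toℕ j ≡ suc (toℕ i) → R (lookup xs i) (lookup xs j)
linked-lookup (r ∷ _)  {zero}  {suc zero} _  = r
linked-lookup (_ ∷ rs) {suc i} {suc j}    eq = linked-lookup rs (suc-injective eq)

last-lookup : ∀ {A : Set} x (xs : List A) (i : Fin (suc (length xs))) → toℕ i ≡ length xs →
              last (x ∷ xs) ≡ just (lookup (x ∷ xs) i)
last-lookup x []       zero    _  = refl
last-lookup x (y ∷ ys) (suc i) eq = last-lookup y ys i (suc-injective eq)

toℕ-next : ∀ {m} (i : Fin (suc m)) → toℕ i < m → toℕ (next i) ≡ suc (toℕ i)
toℕ-next i i<m = trans (toℕ-fromℕ< _) (m<n⇒m%n≡m (s≤s i<m))

next-last : ∀ {m} (i : Fin (suc m)) → toℕ i ≡ m → next i ≡ zero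
next-last {m} i i≡m =
  toℕ-injective (trans (toℕ-fromℕ< _) (trans (cong (λ k → suc k % suc m) i≡m) (n%n≡0 (suc m))))

walk-next : ∀ {A : Set} {_~_ : Rel A 0ℓ} {u v x xs} → Walk _~_ u v (x ∷ xs) → v ~ u →
            ∀ i → lookup (x ∷ xs) i ~ lookup (x ∷ xs) (next i)
walk-next {_~_ = _~_} {u} {v} {x} {xs} p v~u i with toℕ i <? length xs
... | yes i<m = linked-lookup (Walk.linked p) (toℕ-next i i<m)
... | no  i≮m = subst₂ _~_ v≡last u≡first v~u
  where
  i≡m : toℕ i ≡ length xs
  i≡m = ≤-antisym (≤-pred (toℕ<n i)) (≮⇒≥ i≮m)
  v≡last : v ≡ lookup (x ∷ xs) i
  v≡last = just-injective (trans (sym (Walk.end p)) (last-lookup x xs i i≡m))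
  u≡first : u ≡ lookup (x ∷ xs) (next i)
  u≡first = trans (just-injective (sym (Walk.start p))) (cong (lookup (x ∷ xs)) (sym (next-last i i≡m)))

module _ {n : ℕ} where

  cellPos : Cell n → Pos
  cellPos (x , y) = toℕ x , toℕ y

  cellPos-injective : Injective _≡_ _≡_ cellPos
  cellPos-injective eq = cong₂ _,_ (toℕ-injective (cong proj₁ eq)) (toℕ-injective (cong proj₂ eq))

  cellPos∈Box : ∀ c → Box n n (cellPos c)
  cellPos∈Box (x , y) = (z≤n , toℕ<n x) , (z≤n , toℕ<n y)

  toCell : ∀ {p} → Box n n p → Cell n
  toCell ((_ , x<n) , (_ , y<n)) = fromℕ< x<n , fromℕ< y<n

  cellPos-toCell : ∀ {p} (p∈ : Box n n p) → cellPos (toCell p∈) ≡ p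
  cellPos-toCell ((_ , x<n) , (_ , y<n)) = cong₂ _,_ (toℕ-fromℕ< x<n) (toℕ-fromℕ< y<n)

  knight⇒knightAdj : ∀ {c d} → Knight (cellPos c) (cellPos d) → KnightAdj c d
  knight⇒knightAdj (step₂₅ dx dy) = inj₁ (dx , dy)
  knight⇒knightAdj (step₅₂ dx dy) = inj₂ (dx , dy)

  knightsTour : ∀ {u v} → 2 ≤ n → Knight v u → HamPath Knight (Box n n) u v → KnightsTour n
  knightsTour 2≤n v~u record { vertices = [] ; walk = record { start = () } }
  knightsTour 2≤n v~u record { vertices = x ∷ xs ; walk = walk ; enumerates = e } =
    length xs , |cells| , record { order = order ; atLeast3 = atLeast3 ; adjacent = adjacent }
    where
    open Enumerates e
    L = x ∷ xs

    at : Fin (length L) → Cell n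
    at i = toCell (All.lookup sound (∈-lookup i))

    cellPos-at : ∀ i → cellPos (at i) ≡ lookup L i
    cellPos-at i = cellPos-toCell (All.lookup sound (∈-lookup i))

    at-injective : Injective _≡_ _≡_ at
    at-injective {i} {j} eq =
      lookup-injective unique (trans (sym (cellPos-at i)) (trans (cong cellPos eq) (cellPos-at j)))

    at-surjective : ∀ c → ∃ λ i → at i ≡ c
    at-surjective c = Any.index c∈L ,
      cellPos-injective (trans (cellPos-at (Any.index c∈L)) (sym (lookup-index c∈L)))
      where
      c∈L = complete (cellPos∈Box c)

    order : Fin (length L) ⤖ Cell n
    order = mk⤖ (at-injective , λ c → proj₁ (at-surjective c) , λ { refl → proj₂ (at-surjective c) })

    |cells| : length L ≡ n * n
    |cells| = ↔⇒≡ (↔-trans (⤖⇒↔ order) (↔-sym *↔×))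

    atLeast3 : 2 ≤ length xs
    atLeast3 = ≤-pred (<⇒≤ (≤-trans (*-mono-≤ 2≤n 2≤n) (≤-reflexive (sym |cells|))))

    adjacent : ∀ i → KnightAdj (at i) (at (next i))
    adjacent i = knight⇒knightAdj
      (subst₂ Knight (sym (cellPos-at i)) (sym (cellPos-at (next i))) (walk-next walk v~u i))

open Grid Size size≥5 block using (board)

theorem19 : Σ ℕ λ n₀ → (n : ℕ) → 2 ∣ n → n₀ ≤ n → KnightsTour n
theorem19 = 108 , tour
  where
  tour : (n : ℕ) → 2 ∣ n → 108 ≤ n → KnightsTour n
  tour n (divides q n≡q*2) 108≤n with w , ws , sizes , sum≡ ← sizesSummingTo (q ∸ 54) =
    knightsTour 2≤n (step₅₂ refl refl) square
    where
    54≤q : 54 ≤ q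
    54≤q = *-cancelʳ-≤ 54 q 2 (subst (108 ≤_) n≡q*2 108≤n)
    sum≡n : sum (w ∷ ws) ≡ n
    sum≡n = trans sum≡ (trans (cong (_* 2) (m+[n∸m]≡n 54≤q)) (sym n≡q*2))
    2≤n : 2 ≤ n
    2≤n = ≤-trans (m≤m+n 2 106) 108≤n
    square : HamPath Knight (Box n n) (2 , 0) (7 , 2)
    square = subst (λ m → HamPath Knight (Box m m) (2 , 0) (7 , 2)) sum≡n (board sizes sizes)
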